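{- Let $A_\eta(n)=\sum_{k=0}^{n}(-1)^k\binom{n}{k}^3\binom{4n-5k}{3n}$ for $n\ge0$. For any prime $p\ne3$, $$A_\eta\!\left(\left\lfloor \tfrac{p}{3}\right\rfloor\right)\equiv\begin{cases}(-1)^{\lfloor p/5\rfloor}\binom{\lfloor p/3\rfloor}{\lfloor p/15\rfloor}^3, & \text{if } p\equiv1,2,4,8\pmod{15},\\ 0, & \text{otherwise},\end{cases}\pmod p.$$
   Context: For integers $m\ge0$ and any number $x$, $\binom{x}{m}=\frac{x(x-1)\cdots(x-m+1)}{m!}$ (so the upper entry $4n-5k$ may be negative). Equivalently, $A_\eta(0)=1$ and, for $n\ge1$, $A_\eta(n)=\sum_{k=0}^{\lfloor n/5\rfloor}(-1)^k\binom{n}{k}^3\bigl(\binom{4n-5k-1}{3n}+\binom{4n-5k}{3n}\bigr)$. -}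

module Defs where

open import Data.Nat as ℕ using (ℕ; zero; suc; _!)
open import Data.Nat.Properties using (_!≢0)
open import Data.Integer using (ℤ; +_; -_; _+_; _-_; _*_; _/ℕ_)
open import Data.List using (List; map; upTo)
open import Data.List as L using ()

falling : ℤ → ℕ → ℤ
falling x zero    = + 1
falling x (suc m) = falling x m * (x - + m)

-- generalized binomial coefficient  binom x m = x(x-1)...(x-m+1) / m!
-- (the division is exact; upper entry x may be negative)
binom : ℤ → ℕ → ℤ
binom x m = _/ℕ_ (falling x m) (m !) {{m !≢0}}

sgn : ℕ → ℤ
sgn zero    = + 1
sgn (suc k) = - sgn k

_^ℤ_ : ℤ → ℕ → ℤ
x ^ℤ zero  = + 1
x ^ℤ suc k = x * (x ^ℤ k)

sumTo : ℕ → (ℕ → ℤ) → ℤ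
sumTo zero    f = f 0
sumTo (suc n) f = sumTo n f + f (suc n)

Aη : ℕ → ℤ
Aη n = sumTo n (λ k → sgn k * (binom (+ n) k ^ℤ 3)
                       * binom (+ (4 ℕ.* n) - + (5 ℕ.* k)) (3 ℕ.* n))

-- Write p = 3n + e with e ∈ {1, 2}, so n = ⌊p/3⌋ and 3n < p. Modulo p the generalized binomial
-- C(x, 3n) depends only on x mod p; it vanishes when x ≡ i with i < 3n and equals 1 when x ≡ 3n.
-- For 0 ≤ k ≤ n the upper entry 4n − 5k lies in [−n, 4n], so the k-th summand of Aη(n) can survive
-- only if 5k + t ∈ {n, n + p} for some t < e. With n = 5q + c the digits c and e decide this:
-- for p ≡ 1, 2 (mod 15) only k = q survives, for p ≡ 4, 8 only k = 4q + e = n − q, and otherwise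
-- none does. In the surviving case C(4n − 5k, 3n) ≡ 1, and C(n, n − q) = C(n, q) together with the
-- parity of q (p is odd) turns (−1)^k C(n, k)^3 into the stated value.

module Submission where

open import Defs
open import Data.Nat using (ℕ; _/_; _%_)
open import Data.Nat.Primality using (Prime)
open import Data.Integer using (ℤ; +_; _-_; _*_)
open import Data.Integer.Divisibility using (_∣_)
open import Data.Sum using (_⊎_; inj₁; inj₂)
open import Data.Product using (_×_; _,_; proj₂; ∃-syntax)
open import Relation.Binary.PropositionalEquality using (_≡_; _≢_)
open import Relation.Nullary using (¬_; Dec; yes; no)

import Data.Sum
open import Data.Empty using (⊥-elim)
open import Relation.Binary.PropositionalEquality using (refl; sym; trans; cong; cong₂; subst; subst₂; module ≡-Reasoning)
open import Relation.Nullary.Decidable using (True; False; toWitness; toWitnessFalse; from-no; _⊎-dec_)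
open import Data.Nat as ℕ using (zero; suc; _!; z≤n; s≤s; _≤_; _<_)
import Data.Nat.Properties as ℕ
import Data.Nat.DivMod as ℕ
import Data.Nat.Divisibility as ℕ
open import Data.Nat.Properties using (_!≢0)
open import Data.Nat.Primality using (euclidsLemma; ¬prime[1]; prime⇒nonZero; prime⇒irreducible)
open import Data.Nat.Combinatorics using (_C_; nCk+nC[k+1]≡[n+1]C[k+1]; nCn≡1; nCk≡nC[n∸k])
import Data.Nat.Tactic.RingSolver as ℕ-Solver
open import Data.Integer as ℤ using (-[1+_]; -_; _+_; _/ℕ_; _%ℕ_)
import Data.Integer.Properties as ℤ
open import Data.Integer.DivMod using (a≡a%ℕn+[a/ℕn]*n; n%ℕd<d)
open import Data.Integer.Divisibility.Signed as Signed using (divides)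
open import Data.Integer.Tactic.RingSolver using (solve-∀)

-- Integrality of the generalized binomial coefficient

falling-shift : ∀ x m → falling (+ 1 + x) (suc m) ≡ (+ 1 + x) * falling x m
falling-shift x zero = unit (+ 1 + x)
  where
  unit : ∀ y → + 1 * (y - + 0) ≡ y * + 1
  unit = solve-∀
falling-shift x (suc m) = begin
  falling (+ 1 + x) (suc m) * (+ 1 + x - + suc m) ≡⟨ cong (_* (+ 1 + x - + suc m)) (falling-shift x m) ⟩
  (+ 1 + x) * falling x m * (+ 1 + x - (+ 1 + + m)) ≡⟨ shuffle x (falling x m) (+ m) ⟩
  (+ 1 + x) * (falling x m * (x - + m))             ∎
  where
  open ≡-Reasoning
  shuffle : ∀ x f m → (+ 1 + x) * f * (+ 1 + x - (+ 1 + m)) ≡ (+ 1 + x) * (f * (x - m))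
  shuffle = solve-∀

falling-pascal : ∀ x m → falling (+ 1 + x) (suc m) ≡ falling x (suc m) + + suc m * falling x m
falling-pascal x m = trans (falling-shift x m) (split x (falling x m) (+ m))
  where
  split : ∀ x f m → (+ 1 + x) * f ≡ f * (x - m) + (+ 1 + m) * f
  split = solve-∀

falling-zero : ∀ m → falling (+ 0) (suc m) ≡ + 0
falling-zero zero    = refl
falling-zero (suc m) = cong (_* (+ 0 - + suc m)) (falling-zero m)

factorial-∣-falling : ∀ m x → + (m !) Signed.∣ falling x m
factorial-∣-falling zero    x = Signed.∣-refl
factorial-∣-falling (suc m) x = go x
  where
  step : ∀ x → + (suc m !) Signed.∣ + suc m * falling x m
  step x = subst (Signed._∣ + suc m * falling x m) (sym (ℤ.pos-* (suc m) (m !)))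
                 (Signed.*-monoʳ-∣ (+ suc m) (factorial-∣-falling m x))
  up : ∀ n → + (suc m !) Signed.∣ falling (+ n) (suc m)
  up zero    = subst (+ (suc m !) Signed.∣_) (sym (falling-zero m)) (divides (+ 0) refl)
  up (suc n) = subst (+ (suc m !) Signed.∣_) (sym (falling-pascal (+ n) m)) (Signed.∣m∣n⇒∣m+n (up n) (step (+ n)))
  down : ∀ n → + (suc m !) Signed.∣ falling -[1+ n ] (suc m)
  down n = subst (+ (suc m !) Signed.∣_) (unpascal -[1+ n ]) (Signed.∣m∣n⇒∣m-n (above n) (step -[1+ n ]))
    where
    unpascal : ∀ x → falling (+ 1 + x) (suc m) - + suc m * falling x m ≡ falling x (suc m)
    unpascal x = trans (cong (_- + suc m * falling x m) (falling-pascal x m)) (cancel _ _)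
      where
      cancel : ∀ a b → a + b - b ≡ a
      cancel = solve-∀
    above : ∀ n → + (suc m !) Signed.∣ falling (+ 1 + -[1+ n ]) (suc m)
    above zero    = up 0
    above (suc n) = down n
  go : ∀ x → + (suc m !) Signed.∣ falling x (suc m)
  go (+ n)    = up n
  go -[1+ n ] = down n

i*n/ℕn≡i : ∀ i n .{{_ : ℕ.NonZero n}} → (i * + n) /ℕ n ≡ i
i*n/ℕn≡i i n@(suc d) = sym (ℤ.i-j≡0⇒i≡j i q (below-n⇒zero (i - q) remainder (n%ℕd<d (i * + n) n)))
  where
  q = (i * + n) /ℕ n
  remainder : + ((i * + n) %ℕ n) ≡ (i - q) * + n
  remainder = isolate (+ ((i * + n) %ℕ n)) i q (+ n) (a≡a%ℕn+[a/ℕn]*n (i * + n) n)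
    where
    isolate : ∀ r i q n → i * n ≡ r + q * n → r ≡ (i - q) * n
    isolate r i q n eq = trans (sym (cancel r (q * n))) (trans (cong (_- q * n) (sym eq)) (factor i q n))
      where
      cancel : ∀ a b → a + b - b ≡ a
      cancel = solve-∀
      factor : ∀ i q n → i * n - q * n ≡ (i - q) * n
      factor = solve-∀
  below-n⇒zero : ∀ z {r} → + r ≡ z * + n → r < n → z ≡ + 0
  below-n⇒zero (+ zero)  eq r<n = refl
  below-n⇒zero (+ suc k) eq r<n = ⊥-elim (ℕ.<⇒≱ r<n (subst (n ≤_) (sym (ℤ.+-injective eq)) (ℕ.m≤m+n n (k ℕ.* n))))
  below-n⇒zero -[1+ k ]  () r<n

binom*!≡falling : ∀ x m → binom x m * + (m !) ≡ falling x m
binom*!≡falling x m with factorial-∣-falling m x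
... | divides b eq = begin
  binom x m * + (m !)                        ≡⟨ cong (λ y → _/ℕ_ y (m !) {{m !≢0}} * + (m !)) eq ⟩
  _/ℕ_ (b * + (m !)) (m !) {{m !≢0}} * + (m !) ≡⟨ cong (_* + (m !)) (i*n/ℕn≡i b (m !) {{m !≢0}}) ⟩
  b * + (m !)                                ≡⟨ sym eq ⟩
  falling x m                                ∎
  where open ≡-Reasoning

falling-pos : ∀ n k → falling (+ n) k ≡ + (n C k) * + (k !)
falling-pos n       zero    = refl
falling-pos zero    (suc k) = falling-zero k
falling-pos (suc n) (suc k) = begin
  falling (+ 1 + + n) (suc k)
    ≡⟨ falling-pascal (+ n) k ⟩
  falling (+ n) (suc k) + + suc k * falling (+ n) k
    ≡⟨ cong₂ (λ a b → a + + suc k * b) (falling-pos n (suc k)) (falling-pos n k) ⟩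
  + (n C suc k) * + (suc k !) + + suc k * (+ (n C k) * + (k !))
    ≡⟨ cong (λ f → + (n C suc k) * f + + suc k * (+ (n C k) * + (k !))) (ℤ.pos-* (suc k) (k !)) ⟩
  + (n C suc k) * (+ suc k * + (k !)) + + suc k * (+ (n C k) * + (k !))
    ≡⟨ collect (+ (n C k)) (+ (n C suc k)) (+ suc k) (+ (k !)) ⟩
  (+ (n C k) + + (n C suc k)) * (+ suc k * + (k !))
    ≡⟨ cong₂ _*_ pascal (sym (ℤ.pos-* (suc k) (k !))) ⟩
  + (suc n C suc k) * + (suc k !)
    ∎
  where
  open ≡-Reasoning
  collect : ∀ a b s f → b * (s * f) + s * (a * f) ≡ (a + b) * (s * f)
  collect = solve-∀
  pascal : + (n C k) + + (n C suc k) ≡ + (suc n C suc k)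
  pascal = trans (sym (ℤ.pos-+ (n C k) (n C suc k))) (cong +_ (nCk+nC[k+1]≡[n+1]C[k+1] n k))

binom-pos : ∀ n k → binom (+ n) k ≡ + (n C k)
binom-pos n k = ℤ.*-cancelʳ-≡ (binom (+ n) k) (+ (n C k)) (+ (k !)) {{k !≢0}}
  (trans (binom*!≡falling (+ n) k) (falling-pos n k))

binom-symmetric : ∀ a b → binom (+ (a ℕ.+ b)) b ≡ binom (+ (a ℕ.+ b)) a
binom-symmetric a b = begin
  binom (+ (a ℕ.+ b)) b           ≡⟨ binom-pos (a ℕ.+ b) b ⟩
  + ((a ℕ.+ b) C b)               ≡⟨ cong +_ (nCk≡nC[n∸k] (ℕ.m≤n+m b a)) ⟩
  + ((a ℕ.+ b) C (a ℕ.+ b ℕ.∸ b)) ≡⟨ cong (λ k → + ((a ℕ.+ b) C k)) (ℕ.m+n∸n≡m a b) ⟩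
  + ((a ℕ.+ b) C a)               ≡⟨ sym (binom-pos (a ℕ.+ b) a) ⟩
  binom (+ (a ℕ.+ b)) a           ∎
  where open ≡-Reasoning

-- Binomial coefficients modulo a prime

prime∤! : ∀ {p} → Prime p → ∀ m → m < p → ¬ p ℕ.∣ m !
prime∤! pp zero    _   p∣1 with ℕ.∣1⇒≡1 p∣1
... | refl = ¬prime[1] pp
prime∤! pp (suc m) m<p p∣m! with euclidsLemma (suc m) (m !) pp p∣m!
... | inj₁ p∣1+m = ℕ.<⇒≱ m<p (ℕ.∣⇒≤ p∣1+m)
... | inj₂ p∣m!  = prime∤! pp m (ℕ.<-trans (ℕ.n<1+n m) m<p) p∣m!

prime-∣⇒≡ : ∀ {p d} → Prime p → d ℕ.∣ p → 1 < d → d ≡ p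
prime-∣⇒≡ pp d∣p 1<d with prime⇒irreducible pp d∣p
... | inj₁ refl = ⊥-elim (ℕ.<-irrefl refl 1<d)
... | inj₂ d≡p  = d≡p

prime-∣-*!⇒∣ : ∀ {p m} z → Prime p → m < p → + p Signed.∣ z * + (m !) → + p Signed.∣ z
prime-∣-*!⇒∣ {p} {m} z pp m<p p∣z*m!
  with euclidsLemma ℤ.∣ z ∣ (m !) pp (subst (p ℕ.∣_) (ℤ.abs-* z (+ (m !))) (Signed.∣⇒∣ᵤ p∣z*m!))
... | inj₁ p∣z  = Signed.∣ᵤ⇒∣ p∣z
... | inj₂ p∣m! = ⊥-elim (prime∤! pp m m<p p∣m!)

falling-cong : ∀ {d} x y m → d Signed.∣ x - y → d Signed.∣ falling x m - falling y m
falling-cong x y zero    d∣x-y = divides (+ 0) refl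
falling-cong x y (suc m) d∣x-y = subst (_ Signed.∣_) (sym (regroup (falling x m) (falling y m) x y (+ m)))
  (Signed.∣m∣n⇒∣m+n (Signed.∣m⇒∣m*n (x - + m) (falling-cong x y m d∣x-y)) (Signed.∣n⇒∣m*n (falling y m) d∣x-y))
  where
  regroup : ∀ fx fy x y m → fx * (x - m) - fy * (y - m) ≡ (fx - fy) * (x - m) + fy * (x - y)
  regroup = solve-∀

falling-root : ∀ {d} x i m → i < m → d Signed.∣ x - + i → d Signed.∣ falling x m
falling-root x i (suc m) (s≤s i≤m) d∣x-i with i ℕ.≟ m
... | yes refl = Signed.∣n⇒∣m*n (falling x m) d∣x-i
... | no  i≢m  = Signed.∣m⇒∣m*n (x - + m) (falling-root x i m (ℕ.≤∧≢⇒< i≤m i≢m) d∣x-i)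

binom-cong : ∀ {p} x y m → Prime p → m < p → + p Signed.∣ x - y → + p Signed.∣ binom x m - binom y m
binom-cong x y m pp m<p p∣x-y = prime-∣-*!⇒∣ (binom x m - binom y m) pp m<p
  (subst (_ Signed.∣_) factored (falling-cong x y m p∣x-y))
  where
  distrib : ∀ a b f → a * f - b * f ≡ (a - b) * f
  distrib = solve-∀
  factored : falling x m - falling y m ≡ (binom x m - binom y m) * + (m !)
  factored = trans (cong₂ _-_ (sym (binom*!≡falling x m)) (sym (binom*!≡falling y m))) (distrib (binom x m) (binom y m) (+ (m !)))

binom-root : ∀ {p} x i m → Prime p → m < p → i < m → + p Signed.∣ x - + i → + p Signed.∣ binom x m
binom-root x i m pp m<p i<m p∣x-i = prime-∣-*!⇒∣ (binom x m) pp m<p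
  (subst (_ Signed.∣_) (sym (binom*!≡falling x m)) (falling-root x i m i<m p∣x-i))

∣x-x%ℕd : ∀ x d .{{_ : ℕ.NonZero d}} → + d Signed.∣ x - + (x %ℕ d)
∣x-x%ℕd x d = divides (x /ℕ d)
  (trans (cong (_- + (x %ℕ d)) (a≡a%ℕn+[a/ℕn]*n x d)) (cancel (+ (x %ℕ d)) ((x /ℕ d) * + d)))
  where
  cancel : ∀ a b → a + b - a ≡ b
  cancel = solve-∀

binom-mod-prime : ∀ {p} x m → Prime p → m < p →
  + p Signed.∣ binom x m ⊎ ∃[ t ] m ℕ.+ t < p × + p Signed.∣ x - + (m ℕ.+ t)
binom-mod-prime {p} x m pp m<p with _%ℕ_ x p {{prime⇒nonZero pp}} ℕ.<? m
... | yes r<m = inj₁ (binom-root x _ m pp m<p r<m (∣x-x%ℕd x p {{prime⇒nonZero pp}}))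
... | no  r≮m = inj₂ (_ , subst (_< p) (sym m+t≡r) (n%ℕd<d x p {{prime⇒nonZero pp}}) ,
                          subst (λ s → + p Signed.∣ x - + s) (sym m+t≡r) (∣x-x%ℕd x p {{prime⇒nonZero pp}}))
  where m+t≡r = ℕ.m+[n∸m]≡n (ℕ.≮⇒≥ r≮m)

sumTo-∣ : ∀ {d} n f → (∀ k → k ≤ n → d Signed.∣ f k) → d Signed.∣ sumTo n f
sumTo-∣ zero    f d∣f = d∣f 0 z≤n
sumTo-∣ (suc n) f d∣f =
  Signed.∣m∣n⇒∣m+n (sumTo-∣ n f (λ k k≤n → d∣f k (ℕ.m≤n⇒m≤1+n k≤n))) (d∣f (suc n) ℕ.≤-refl)

sumTo-∣-single : ∀ {d} n f {k₀} v → k₀ ≤ n → (∀ k → k ≤ n → k ≢ k₀ → d Signed.∣ f k) →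
                 d Signed.∣ f k₀ - v → d Signed.∣ sumTo n f - v
sumTo-∣-single zero    f v z≤n d∣others d∣fk₀-v = d∣fk₀-v
sumTo-∣-single (suc n) f v k₀≤1+n d∣others d∣fk₀-v with ℕ.m≤n⇒m<n∨m≡n k₀≤1+n
... | inj₁ (s≤s k₀≤n) = subst (_ Signed.∣_) (shuffle (sumTo n f) (f (suc n)) v)
  (Signed.∣m∣n⇒∣m+n (sumTo-∣-single n f v k₀≤n (λ k k≤n → d∣others k (ℕ.m≤n⇒m≤1+n k≤n)) d∣fk₀-v)
                    (d∣others (suc n) ℕ.≤-refl (λ { refl → ℕ.<-irrefl refl (s≤s k₀≤n) })))
  where
  shuffle : ∀ s a v → (s - v) + a ≡ s + a - v
  shuffle = solve-∀
... | inj₂ refl = subst (_ Signed.∣_) (assoc (sumTo n f) (f (suc n)) v)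
  (Signed.∣m∣n⇒∣m+n (sumTo-∣ n f (λ k k≤n → d∣others k (ℕ.m≤n⇒m≤1+n k≤n) (ℕ.<⇒≢ (s≤s k≤n))))
                    d∣fk₀-v)
  where
  assoc : ∀ s a v → s + (a - v) ≡ s + a - v
  assoc = solve-∀

-- The summands of Aη(n) modulo p = 3n + e

Aη-summand : ℕ → ℕ → ℤ
Aη-summand n k = sgn k * (binom (+ n) k ^ℤ 3) * binom (+ (4 ℕ.* n) - + (5 ℕ.* k)) (3 ℕ.* n)

-- 4n − 5k ≡ 3n + t (mod p) with 3n + t < p, stated as 5k + t ∈ {n, n + p} (all solutions when k ≤ n).
Exceptional : ℕ → ℕ → ℕ → Set
Exceptional p n k = ∃[ t ] 3 ℕ.* n ℕ.+ t < p × (5 ℕ.* k ℕ.+ t ≡ n ⊎ 5 ℕ.* k ℕ.+ t ≡ n ℕ.+ p)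

+a-+b≡+c⇒a≡b+c : ∀ a b c → + a - + b ≡ + c → a ≡ b ℕ.+ c
+a-+b≡+c⇒a≡b+c a b c eq = ℤ.+-injective (trans (sym (cancel (+ a) (+ b))) (trans (cong (_+_ (+ b)) eq) (sym (ℤ.pos-+ b c))))
  where
  cancel : ∀ a b → b + (a - b) ≡ a
  cancel = solve-∀

+a-+b≡-+c⇒b≡a+c : ∀ a b c → + a - + b ≡ - + c → b ≡ a ℕ.+ c
+a-+b≡-+c⇒b≡a+c a b c eq =
  +a-+b≡+c⇒a≡b+c b a c (trans (sym (flip (+ a) (+ b))) (trans (cong -_ eq) (ℤ.neg-involutive (+ c))))
  where
  flip : ∀ a b → - (a - b) ≡ b - a
  flip = solve-∀

p∣a-b⇒b≡a⊎b≡a+p : ∀ {p a b} → + p Signed.∣ + a - + b → a < p → b < a ℕ.+ 2 ℕ.* p → b ≡ a ⊎ b ≡ a ℕ.+ p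
p∣a-b⇒b≡a⊎b≡a+p {p} {a} {b} (divides (+ zero) eq) a<p b<a+2p =
  inj₁ (sym (ℤ.+-injective (ℤ.i-j≡0⇒i≡j (+ a) (+ b) eq)))
p∣a-b⇒b≡a⊎b≡a+p {p} {a} {b} (divides (+ suc m) eq) a<p b<a+2p =
  ⊥-elim (ℕ.<⇒≱ a<p (subst (p ≤_) (sym a≡b+p+mp) (ℕ.≤-trans (ℕ.m≤m+n p (m ℕ.* p)) (ℕ.m≤n+m _ b))))
  where a≡b+p+mp = +a-+b≡+c⇒a≡b+c a b (suc m ℕ.* p) (trans eq (sym (ℤ.pos-* (suc m) p)))
p∣a-b⇒b≡a⊎b≡a+p {p} {a} {b} (divides -[1+ m ] eq) a<p b<a+2p with +a-+b≡-+c⇒b≡a+c a b (suc m ℕ.* p) (trans eq negative)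
  where
  negative : -[1+ m ] * + p ≡ - + (suc m ℕ.* p)
  negative = trans (sym (ℤ.neg-distribˡ-* (+ suc m) (+ p))) (cong -_ (sym (ℤ.pos-* (suc m) p)))
p∣a-b⇒b≡a⊎b≡a+p {p} {a} {b} (divides -[1+ zero ] eq) a<p b<a+2p | b≡a+p+0 =
  inj₂ (trans b≡a+p+0 (cong (a ℕ.+_) (ℕ.+-identityʳ p)))
p∣a-b⇒b≡a⊎b≡a+p {p} {a} {b} (divides -[1+ suc m ] eq) a<p b<a+2p | b≡a+2p+mp =
  ⊥-elim (ℕ.<⇒≱ b<a+2p (subst (a ℕ.+ 2 ℕ.* p ≤_) (sym b≡a+2p+mp)
    (ℕ.+-monoʳ-≤ a (ℕ.+-monoʳ-≤ p (ℕ.+-monoʳ-≤ p (z≤n {m ℕ.* p}))))))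

summand-argument : ∀ n k t → + (4 ℕ.* n) - + (5 ℕ.* k) - + (3 ℕ.* n ℕ.+ t) ≡ + n - + (5 ℕ.* k ℕ.+ t)
summand-argument n k t = begin
  + (4 ℕ.* n) - + (5 ℕ.* k) - + (3 ℕ.* n ℕ.+ t)
    ≡⟨ cong₂ (λ a b → a - + (5 ℕ.* k) - b) (ℤ.pos-* 4 n) (ℤ.pos-+ (3 ℕ.* n) t) ⟩
  + 4 * + n - + (5 ℕ.* k) - (+ (3 ℕ.* n) + + t)
    ≡⟨ cong₂ (λ a b → + 4 * + n - a - (b + + t)) (ℤ.pos-* 5 k) (ℤ.pos-* 3 n) ⟩
  + 4 * + n - + 5 * + k - (+ 3 * + n + + t)         ≡⟨ linear (+ n) (+ k) (+ t) ⟩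
  + n - (+ 5 * + k + + t)                           ≡⟨ cong (λ a → + n - (a + + t)) (sym (ℤ.pos-* 5 k)) ⟩
  + n - (+ (5 ℕ.* k) + + t)                         ≡⟨ cong (_-_ (+ n)) (sym (ℤ.pos-+ (5 ℕ.* k) t)) ⟩
  + n - + (5 ℕ.* k ℕ.+ t)                           ∎
  where
  open ≡-Reasoning
  linear : ∀ n k t → + 4 * n - + 5 * k - (+ 3 * n + t) ≡ n - (+ 5 * k + t)
  linear = solve-∀

exceptional-bound : ∀ {p n k t} → k ≤ n → 3 ℕ.* n ℕ.+ t < p → 5 ℕ.* k ℕ.+ t < n ℕ.+ 2 ℕ.* p
exceptional-bound {p} {n} {k} {t} k≤n 3n+t<p = begin-strict
  5 ℕ.* k ℕ.+ t           ≤⟨ ℕ.+-monoˡ-≤ t (ℕ.*-monoʳ-≤ 5 k≤n) ⟩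
  5 ℕ.* n ℕ.+ t           ≡⟨ split n t ⟩
  2 ℕ.* n ℕ.+ (3 ℕ.* n ℕ.+ t) <⟨ ℕ.+-monoʳ-< (2 ℕ.* n) 3n+t<p ⟩
  2 ℕ.* n ℕ.+ p           ≡⟨ regroup n p ⟩
  n ℕ.+ (n ℕ.+ p)         ≤⟨ ℕ.+-monoʳ-≤ n (ℕ.+-monoˡ-≤ p n≤p) ⟩
  n ℕ.+ (p ℕ.+ p)         ≡⟨ sym (regroup₂ n p) ⟩
  n ℕ.+ 2 ℕ.* p           ∎
  where
  open ℕ.≤-Reasoning
  n≤p = ℕ.<⇒≤ (ℕ.≤-<-trans (ℕ.≤-trans (ℕ.m≤n*m n 3) (ℕ.m≤m+n (3 ℕ.* n) t)) 3n+t<p)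
  split : ∀ n t → 5 ℕ.* n ℕ.+ t ≡ 2 ℕ.* n ℕ.+ (3 ℕ.* n ℕ.+ t)
  split = ℕ-Solver.solve-∀
  regroup : ∀ n p → 2 ℕ.* n ℕ.+ p ≡ n ℕ.+ (n ℕ.+ p)
  regroup = ℕ-Solver.solve-∀
  regroup₂ : ∀ n p → n ℕ.+ 2 ℕ.* p ≡ n ℕ.+ (p ℕ.+ p)
  regroup₂ = ℕ-Solver.solve-∀

Aη-summand-∣ : ∀ {p n k} → Prime p → 3 ℕ.* n < p → k ≤ n → ¬ Exceptional p n k → + p Signed.∣ Aη-summand n k
Aη-summand-∣ {p} {n} {k} pp 3n<p k≤n regular with binom-mod-prime (+ (4 ℕ.* n) - + (5 ℕ.* k)) (3 ℕ.* n) pp 3n<p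
... | inj₁ p∣binom = Signed.∣n⇒∣m*n (sgn k * (binom (+ n) k ^ℤ 3)) p∣binom
... | inj₂ (t , 3n+t<p , p∣x-3n-t) = ⊥-elim (regular (t , 3n+t<p ,
  p∣a-b⇒b≡a⊎b≡a+p (subst (+ p Signed.∣_) (summand-argument n k t) p∣x-3n-t)
               (ℕ.≤-<-trans (ℕ.m≤n*m n 3) 3n<p) (exceptional-bound k≤n 3n+t<p)))

m≡n⊎m≡n+p⇒p∣n-m : ∀ {p n m} → m ≡ n ⊎ m ≡ n ℕ.+ p → + p Signed.∣ + n - + m
m≡n⊎m≡n+p⇒p∣n-m {n = n} (inj₁ refl) = divides (+ 0) (ℤ.+-inverseʳ (+ n))
m≡n⊎m≡n+p⇒p∣n-m {p} {n} (inj₂ refl) = divides -[1+ 0 ]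
  (trans (cong (_-_ (+ n)) (ℤ.pos-+ n p)) (trans (cancel (+ n) (+ p)) (sym (ℤ.-1*i≡-i (+ p)))))
  where
  cancel : ∀ n p → n - (n + p) ≡ - p
  cancel = solve-∀

Aη-summand-≡ : ∀ {p n k} → Prime p → 3 ℕ.* n < p → 5 ℕ.* k ≡ n ⊎ 5 ℕ.* k ≡ n ℕ.+ p →
           + p Signed.∣ Aη-summand n k - sgn k * (binom (+ n) k ^ℤ 3)
Aη-summand-≡ {p} {n} {k} pp 3n<p central =
  subst (+ p Signed.∣_) (factor v (binom x (3 ℕ.* n)))
    (Signed.∣n⇒∣m*n v (subst (λ c → + p Signed.∣ binom x (3 ℕ.* n) - c) binom-3n-3n
      (binom-cong x (+ (3 ℕ.* n)) (3 ℕ.* n) pp 3n<p p∣x-3n)))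
  where
  v = sgn k * (binom (+ n) k ^ℤ 3)
  x = + (4 ℕ.* n) - + (5 ℕ.* k)
  factor : ∀ v c → v * (c - + 1) ≡ v * c - v
  factor = solve-∀
  binom-3n-3n : binom (+ (3 ℕ.* n)) (3 ℕ.* n) ≡ + 1
  binom-3n-3n = trans (binom-pos (3 ℕ.* n) (3 ℕ.* n)) (cong +_ (nCn≡1 (3 ℕ.* n)))
  p∣x-3n : + p Signed.∣ x - + (3 ℕ.* n)
  p∣x-3n = subst (λ s → + p Signed.∣ x - + s) (ℕ.+-identityʳ (3 ℕ.* n))
    (subst (+ p Signed.∣_) (sym (summand-argument n k 0))
      (subst (λ s → + p Signed.∣ + n - + s) (sym (ℕ.+-identityʳ (5 ℕ.* k))) (m≡n⊎m≡n+p⇒p∣n-m central)))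

Aη-∣ : ∀ {p n} → Prime p → 3 ℕ.* n < p → (∀ k → k ≤ n → ¬ Exceptional p n k) → + p Signed.∣ Aη n
Aη-∣ {n = n} pp 3n<p regular = sumTo-∣ n (Aη-summand n) (λ k k≤n → Aη-summand-∣ pp 3n<p k≤n (regular k k≤n))

Aη-≡ : ∀ {p n k₀} → Prime p → 3 ℕ.* n < p → k₀ ≤ n → 5 ℕ.* k₀ ≡ n ⊎ 5 ℕ.* k₀ ≡ n ℕ.+ p →
       (∀ k → k ≤ n → Exceptional p n k → k ≡ k₀) → + p Signed.∣ Aη n - sgn k₀ * (binom (+ n) k₀ ^ℤ 3)
Aη-≡ {n = n} {k₀} pp 3n<p k₀≤n central unique =
  sumTo-∣-single n (Aη-summand n) (sgn k₀ * (binom (+ n) k₀ ^ℤ 3)) k₀≤n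
  (λ k k≤n k≢k₀ → Aη-summand-∣ pp 3n<p k≤n (λ ex → k≢k₀ (unique k k≤n ex)))
  (Aη-summand-≡ {k = k₀} pp 3n<p central)

-- Base-5 digits of n = c + 5q

digits-unique : ∀ {d} .{{_ : ℕ.NonZero d}} t k u l → t ℕ.+ k ℕ.* d ≡ u ℕ.+ l ℕ.* d → t < d → u < d →
                t ≡ u × k ≡ l
digits-unique {d} t k u l eq t<d u<d =
  t≡u , ℕ.*-cancelʳ-≡ k l d (ℕ.+-cancelˡ-≡ t _ _ (trans eq (cong (ℕ._+ l ℕ.* d) (sym t≡u))))
  where
  open ≡-Reasoning
  t≡u = begin
    t                   ≡⟨ sym (ℕ.m<n⇒m%n≡m t<d) ⟩
    t % d               ≡⟨ sym (ℕ.[m+kn]%n≡m%n t k d) ⟩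
    (t ℕ.+ k ℕ.* d) % d ≡⟨ cong (_% d) eq ⟩
    (u ℕ.+ l ℕ.* d) % d ≡⟨ ℕ.[m+kn]%n≡m%n u l d ⟩
    u % d               ≡⟨ ℕ.m<n⇒m%n≡m u<d ⟩
    u                   ∎

m/d≡k : ∀ {m d} .{{_ : ℕ.NonZero d}} r k → m ≡ r ℕ.+ k ℕ.* d → r < d → m / d ≡ k
m/d≡k {m} {d} r k m≡ r<d =
  sym (proj₂ (digits-unique r k (m % d) (m / d) (trans (sym m≡) (ℕ.m≡m%n+[m/n]*n m d)) r<d (ℕ.m%n<n m d)))

exceptional⇒below-gap : ∀ {p n e k} → p ≡ e ℕ.+ n ℕ.* 3 → Exceptional p n k →
  ∃[ t ] t < e × (t ℕ.+ k ℕ.* 5 ≡ n ⊎ t ℕ.+ k ℕ.* 5 ≡ n ℕ.+ p)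
exceptional⇒below-gap {p} {n} {e} {k} refl (t , 3n+t<p , central) =
  t , ℕ.+-cancelˡ-< (3 ℕ.* n) t e (subst (3 ℕ.* n ℕ.+ t <_) (swap₁ e n) 3n+t<p) ,
  Data.Sum.map (trans (swap₂ k t)) (trans (swap₂ k t)) central
  where
  swap₁ : ∀ e n → e ℕ.+ n ℕ.* 3 ≡ 3 ℕ.* n ℕ.+ e
  swap₁ = ℕ-Solver.solve-∀
  swap₂ : ∀ k t → t ℕ.+ k ℕ.* 5 ≡ 5 ℕ.* k ℕ.+ t
  swap₂ = ℕ-Solver.solve-∀

gap⇒3n<p : ∀ {p n e} → p ≡ e ℕ.+ n ℕ.* 3 → 1 ≤ e → 3 ℕ.* n < p
gap⇒3n<p {p} {n} {e} refl 1≤e = subst (3 ℕ.* n <_) (swap n e) (ℕ.m<m+n (3 ℕ.* n) 1≤e)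
  where
  swap : ∀ n e → 3 ℕ.* n ℕ.+ e ≡ e ℕ.+ n ℕ.* 3
  swap = ℕ-Solver.solve-∀

n+p-digits : ∀ q c e → (c ℕ.+ q ℕ.* 5) ℕ.+ (e ℕ.+ (c ℕ.+ q ℕ.* 5) ℕ.* 3) ≡
                         (4 ℕ.* c ℕ.+ e) % 5 ℕ.+ ((4 ℕ.* c ℕ.+ e) / 5 ℕ.+ q ℕ.* 4) ℕ.* 5
n+p-digits q c e = begin
  (c ℕ.+ q ℕ.* 5) ℕ.+ (e ℕ.+ (c ℕ.+ q ℕ.* 5) ℕ.* 3) ≡⟨ collect q c e ⟩
  (4 ℕ.* c ℕ.+ e) ℕ.+ q ℕ.* 4 ℕ.* 5
    ≡⟨ cong (ℕ._+ q ℕ.* 4 ℕ.* 5) (ℕ.m≡m%n+[m/n]*n (4 ℕ.* c ℕ.+ e) 5) ⟩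
  (s ℕ.+ b ℕ.* 5) ℕ.+ q ℕ.* 4 ℕ.* 5                  ≡⟨ regroup s b q ⟩
  s ℕ.+ (b ℕ.+ q ℕ.* 4) ℕ.* 5                        ∎
  where
  open ≡-Reasoning
  s = (4 ℕ.* c ℕ.+ e) % 5
  b = (4 ℕ.* c ℕ.+ e) / 5
  collect : ∀ q c e → (c ℕ.+ q ℕ.* 5) ℕ.+ (e ℕ.+ (c ℕ.+ q ℕ.* 5) ℕ.* 3) ≡ (4 ℕ.* c ℕ.+ e) ℕ.+ q ℕ.* 4 ℕ.* 5
  collect = ℕ-Solver.solve-∀
  regroup : ∀ s b q → (s ℕ.+ b ℕ.* 5) ℕ.+ q ℕ.* 4 ℕ.* 5 ≡ s ℕ.+ (b ℕ.+ q ℕ.* 4) ℕ.* 5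
  regroup = ℕ-Solver.solve-∀

exceptional-digits : ∀ {p n q c e k} → p ≡ e ℕ.+ n ℕ.* 3 → n ≡ c ℕ.+ q ℕ.* 5 → c < 5 → e ≤ 5 →
  Exceptional p n k →
  c < e × k ≡ q ⊎ (4 ℕ.* c ℕ.+ e) % 5 < e × k ≡ (4 ℕ.* c ℕ.+ e) / 5 ℕ.+ q ℕ.* 4
exceptional-digits {q = q} {c} {e} {k} refl refl c<5 e≤5 ex = digits (exceptional⇒below-gap {k = k} refl ex)
  where
  digits : ∃[ t ] t < e × (t ℕ.+ k ℕ.* 5 ≡ c ℕ.+ q ℕ.* 5
                          ⊎ t ℕ.+ k ℕ.* 5 ≡ (c ℕ.+ q ℕ.* 5) ℕ.+ (e ℕ.+ (c ℕ.+ q ℕ.* 5) ℕ.* 3)) →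
           c < e × k ≡ q ⊎ (4 ℕ.* c ℕ.+ e) % 5 < e × k ≡ (4 ℕ.* c ℕ.+ e) / 5 ℕ.+ q ℕ.* 4
  digits (t , t<e , inj₁ t+5k≡n) =
    let t≡c , k≡q = digits-unique t k c q t+5k≡n (ℕ.<-≤-trans t<e e≤5) c<5
    in inj₁ (subst (_< e) t≡c t<e , k≡q)
  digits (t , t<e , inj₂ t+5k≡n+p) =
    let t≡s , k≡j = digits-unique t k ((4 ℕ.* c ℕ.+ e) % 5) ((4 ℕ.* c ℕ.+ e) / 5 ℕ.+ q ℕ.* 4)
                      (trans t+5k≡n+p (n+p-digits q c e)) (ℕ.<-≤-trans t<e e≤5) (ℕ.m%n<n (4 ℕ.* c ℕ.+ e) 5)
    in inj₂ (subst (_< e) t≡s t<e , k≡j)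

Aη-ordinary : ∀ {p n q c e} → Prime p → p ≡ e ℕ.+ n ℕ.* 3 → n ≡ c ℕ.+ q ℕ.* 5 → 1 ≤ e → e ≤ 5 → c < 5 →
              e ≤ c → e ≤ (4 ℕ.* c ℕ.+ e) % 5 → + p Signed.∣ Aη n
Aη-ordinary {p} {n} {q} {c} {e} pp p≡ n≡ 1≤e e≤5 c<5 e≤c e≤s = Aη-∣ pp (gap⇒3n<p {n = n} p≡ 1≤e) regular
  where
  regular : ∀ k → k ≤ n → ¬ Exceptional p n k
  regular k _ ex with exceptional-digits {n = n} {q} {c} {e} {k} p≡ n≡ c<5 e≤5 ex
  ... | inj₁ (c<e , _) = ℕ.<⇒≱ c<e e≤c
  ... | inj₂ (s<e , _) = ℕ.<⇒≱ s<e e≤s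

Aη-special-A : ∀ {p n q e} → Prime p → p ≡ e ℕ.+ n ℕ.* 3 → n ≡ q ℕ.* 5 → 1 ≤ e → e < 5 →
               + p Signed.∣ Aη n - sgn q * (binom (+ n) q ^ℤ 3)
Aη-special-A {p} {n} {q} {e} pp p≡ n≡ 1≤e e<5 =
  Aη-≡ {k₀ = q} pp (gap⇒3n<p {n = n} p≡ 1≤e) (subst (q ≤_) (sym n≡) (ℕ.m≤m*n q 5))
       (inj₁ (trans (ℕ.*-comm 5 q) (sym n≡))) unique
  where
  unique : ∀ k → k ≤ n → Exceptional p n k → k ≡ q
  unique k _ ex with exceptional-digits {n = n} {q} {0} {e} {k} p≡ n≡ (s≤s z≤n) (ℕ.<⇒≤ e<5) ex
  ... | inj₁ (_ , k≡q) = k≡q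
  ... | inj₂ (e%5<e , _) = ⊥-elim (ℕ.<-irrefl (ℕ.m<n⇒m%n≡m e<5) e%5<e)

Aη-special-B : ∀ {p n q e} → Prime p → p ≡ e ℕ.+ n ℕ.* 3 → n ≡ e ℕ.+ q ℕ.* 5 → 1 ≤ e → e < 5 →
               + p Signed.∣ Aη n - sgn (e ℕ.+ q ℕ.* 4) * (binom (+ n) (e ℕ.+ q ℕ.* 4) ^ℤ 3)
Aη-special-B {p} {n} {q} {e} pp p≡ n≡ 1≤e e<5 =
  Aη-≡ {k₀ = k₀} pp (gap⇒3n<p {n = n} p≡ 1≤e) k₀≤n (inj₂ central) unique
  where
  k₀ = e ℕ.+ q ℕ.* 4
  k₀≤n : k₀ ≤ n
  k₀≤n = subst (k₀ ≤_) (sym n≡) (ℕ.+-monoʳ-≤ e (ℕ.*-monoʳ-≤ q (ℕ.n≤1+n 4)))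
  collect : ∀ q e → 5 ℕ.* (e ℕ.+ q ℕ.* 4) ≡ (e ℕ.+ q ℕ.* 5) ℕ.+ (e ℕ.+ (e ℕ.+ q ℕ.* 5) ℕ.* 3)
  collect = ℕ-Solver.solve-∀
  central : 5 ℕ.* k₀ ≡ n ℕ.+ p
  central = trans (collect q e) (sym (cong₂ ℕ._+_ n≡ (trans p≡ (cong (λ n → e ℕ.+ n ℕ.* 3) n≡))))
  five : ∀ e → 4 ℕ.* e ℕ.+ e ≡ e ℕ.* 5
  five = ℕ-Solver.solve-∀
  unique : ∀ k → k ≤ n → Exceptional p n k → k ≡ k₀
  unique k _ ex with exceptional-digits {n = n} {q} {e} {e} {k} p≡ n≡ e<5 (ℕ.<⇒≤ e<5) ex
  ... | inj₁ (e<e , _) = ⊥-elim (ℕ.<-irrefl refl e<e)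
  ... | inj₂ (_ , k≡j) = trans k≡j (cong (ℕ._+ q ℕ.* 4) (trans (ℕ./-congˡ (five e)) (ℕ.m*n/n≡m e 5)))

sgn-+-double : ∀ m j → sgn (m ℕ.+ j ℕ.* 2) ≡ sgn m
sgn-+-double m zero    = cong sgn (ℕ.+-identityʳ m)
sgn-+-double m (suc j) = trans (cong sgn (two-more m j)) (trans (ℤ.neg-involutive _) (sgn-+-double m j))
  where
  two-more : ∀ m j → m ℕ.+ suc j ℕ.* 2 ≡ suc (suc (m ℕ.+ j ℕ.* 2))
  two-more = ℕ-Solver.solve-∀

quotient-odd : ∀ {p} a q → Prime p → p ≡ a ℕ.* 2 ℕ.+ q ℕ.* 15 → 2 < p → ∃[ j ] q ≡ 1 ℕ.+ j ℕ.* 2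
quotient-odd {p} a q pp p≡ 2<p with q % 2 | ℕ.m≡m%n+[m/n]*n q 2 | ℕ.m%n<n q 2
... | 0 | q≡ | _ =
  ⊥-elim (ℕ.<-irrefl (prime-∣⇒≡ pp (ℕ.divides (a ℕ.+ (q / 2) ℕ.* 15) p≡2k) (s≤s (s≤s z≤n))) 2<p)
  where
  factor : ∀ a h → a ℕ.* 2 ℕ.+ (h ℕ.* 2) ℕ.* 15 ≡ (a ℕ.+ h ℕ.* 15) ℕ.* 2
  factor = ℕ-Solver.solve-∀
  p≡2k = trans p≡ (trans (cong (λ q → a ℕ.* 2 ℕ.+ q ℕ.* 15) q≡) (factor a (q / 2)))
... | 1 | q≡ | _ = q / 2 , q≡
... | suc (suc _) | _ | s≤s (s≤s ())

SpecialResidue : ℕ → Set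
SpecialResidue r = r ≡ 1 ⊎ r ≡ 2 ⊎ r ≡ 4 ⊎ r ≡ 8

special? : ∀ r → Dec (SpecialResidue r)
special? r = r ℕ.≟ 1 ⊎-dec r ℕ.≟ 2 ⊎-dec r ℕ.≟ 4 ⊎-dec r ℕ.≟ 8

AηCongruence : ℕ → Set
AηCongruence p = (SpecialResidue (p % 15) → + p ∣ Aη (p / 3) - sgn (p / 5) * (binom (+ (p / 3)) (p / 15) ^ℤ 3))
               × (¬ SpecialResidue (p % 15) → + p ∣ Aη (p / 3))

congruence-from-special : ∀ {p k₀} → SpecialResidue (p % 15) → sgn (p / 5) ≡ sgn k₀ →
  binom (+ (p / 3)) (p / 15) ≡ binom (+ (p / 3)) k₀ →
  + p Signed.∣ Aη (p / 3) - sgn k₀ * (binom (+ (p / 3)) k₀ ^ℤ 3) → AηCongruence p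
congruence-from-special {p} special sgn≡ binom≡ p∣ =
  (λ _ → Signed.∣⇒∣ᵤ (subst₂ (λ s b → + p Signed.∣ Aη (p / 3) - s * (b ^ℤ 3)) (sym sgn≡) (sym binom≡) p∣)) ,
  (λ ordinary → ⊥-elim (ordinary special))

congruence-from-ordinary : ∀ {p} → ¬ SpecialResidue (p % 15) → + p Signed.∣ Aη (p / 3) → AηCongruence p
congruence-from-ordinary ordinary p∣ = (λ special → ⊥-elim (ordinary special)) , (λ _ → Signed.∣⇒∣ᵤ p∣)

congruence-A : ∀ {p} q e → Prime p → p ≡ e ℕ.+ (p / 3) ℕ.* 3 → p / 3 ≡ q ℕ.* 5 → p / 15 ≡ q → p % 15 ≡ e →
  {_ : True (1 ℕ.≤? e)} {_ : True (e ℕ.<? 5)} {_ : True (special? e)} → AηCongruence p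
congruence-A {p} q e pp p≡ n≡ p/15≡q p%15≡e {1≤e} {e<5} {special} =
  congruence-from-special {k₀ = q} (subst SpecialResidue (sym p%15≡e) (toWitness special)) sgn≡ (cong (binom (+ (p / 3))) p/15≡q)
    (Aη-special-A {n = p / 3} {q} {e} pp p≡ n≡ (toWitness 1≤e) (toWitness e<5))
  where
  regroup : ∀ q → (q ℕ.* 5) ℕ.* 3 ≡ (q ℕ.* 3) ℕ.* 5
  regroup = ℕ-Solver.solve-∀
  p/5≡3q : p / 5 ≡ q ℕ.* 3
  p/5≡3q = m/d≡k e (q ℕ.* 3) (trans p≡ (trans (cong (λ n → e ℕ.+ n ℕ.* 3) n≡) (cong (e ℕ.+_) (regroup q))))
                   (toWitness e<5)
  sgn≡ : sgn (p / 5) ≡ sgn q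
  sgn≡ = trans (cong sgn (trans p/5≡3q (triple q))) (sgn-+-double q q)
    where
    triple : ∀ q → q ℕ.* 3 ≡ q ℕ.+ q ℕ.* 2
    triple = ℕ-Solver.solve-∀

-- The surviving index k₀ = 4q + e = n − q exceeds ⌊p/5⌋ by q + 1, which is even since p is odd.
congruence-B : ∀ {p} q e → Prime p → p ≡ e ℕ.+ (p / 3) ℕ.* 3 → p / 3 ≡ e ℕ.+ q ℕ.* 5 → p / 15 ≡ q →
  p % 15 ≡ e ℕ.+ e ℕ.* 3 → {_ : True (1 ℕ.≤? e)} {_ : True (e ℕ.<? 5)} {_ : True (special? (e ℕ.+ e ℕ.* 3))}
  {_ : True ((4 ℕ.* e) / 5 ℕ.+ 1 ℕ.≟ e)} → AηCongruence p
congruence-B {p} q e pp p≡ n≡ p/15≡q p%15≡ {1≤e} {e<5} {special} {carry} =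
  congruence-from-special {k₀ = k₀} (subst SpecialResidue (sym p%15≡) (toWitness special)) sgn≡ binom≡
    (Aη-special-B {n = p / 3} {q} {e} pp p≡ n≡ (toWitness 1≤e) (toWitness e<5))
  where
  open ≡-Reasoning
  k₀ = e ℕ.+ q ℕ.* 4
  p≡4e+15q : p ≡ e ℕ.* 2 ℕ.* 2 ℕ.+ q ℕ.* 15
  p≡4e+15q = trans p≡ (trans (cong (λ n → e ℕ.+ n ℕ.* 3) n≡) (collect e q))
    where
    collect : ∀ e q → e ℕ.+ (e ℕ.+ q ℕ.* 5) ℕ.* 3 ≡ e ℕ.* 2 ℕ.* 2 ℕ.+ q ℕ.* 15
    collect = ℕ-Solver.solve-∀
  p/5≡ : p / 5 ≡ (4 ℕ.* e) / 5 ℕ.+ q ℕ.* 3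
  p/5≡ = m/d≡k ((4 ℕ.* e) % 5) ((4 ℕ.* e) / 5 ℕ.+ q ℕ.* 3) p≡ₛ (ℕ.m%n<n (4 ℕ.* e) 5)
    where
    regroup : ∀ e s b q → s ℕ.+ b ℕ.* 5 ≡ 4 ℕ.* e →
              e ℕ.* 2 ℕ.* 2 ℕ.+ q ℕ.* 15 ≡ s ℕ.+ (b ℕ.+ q ℕ.* 3) ℕ.* 5
    regroup e s b q eq = trans (four e q) (trans (cong (ℕ._+ q ℕ.* 15) (sym eq)) (distrib s b q))
      where
      four : ∀ e q → e ℕ.* 2 ℕ.* 2 ℕ.+ q ℕ.* 15 ≡ 4 ℕ.* e ℕ.+ q ℕ.* 15
      four = ℕ-Solver.solve-∀
      distrib : ∀ s b q → s ℕ.+ b ℕ.* 5 ℕ.+ q ℕ.* 15 ≡ s ℕ.+ (b ℕ.+ q ℕ.* 3) ℕ.* 5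
      distrib = ℕ-Solver.solve-∀
    p≡ₛ = trans p≡4e+15q (regroup e ((4 ℕ.* e) % 5) ((4 ℕ.* e) / 5) q (sym (ℕ.m≡m%n+[m/n]*n (4 ℕ.* e) 5)))
  p/5+[1+q]≡k₀ : p / 5 ℕ.+ (1 ℕ.+ q) ≡ k₀
  p/5+[1+q]≡k₀ = begin
    p / 5 ℕ.+ (1 ℕ.+ q)                     ≡⟨ cong (ℕ._+ (1 ℕ.+ q)) p/5≡ ⟩
    (4 ℕ.* e) / 5 ℕ.+ q ℕ.* 3 ℕ.+ (1 ℕ.+ q) ≡⟨ regroup ((4 ℕ.* e) / 5) q ⟩
    ((4 ℕ.* e) / 5 ℕ.+ 1) ℕ.+ q ℕ.* 4       ≡⟨ cong (ℕ._+ q ℕ.* 4) (toWitness carry) ⟩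
    k₀                                      ∎
    where
    regroup : ∀ b q → b ℕ.+ q ℕ.* 3 ℕ.+ (1 ℕ.+ q) ≡ (b ℕ.+ 1) ℕ.+ q ℕ.* 4
    regroup = ℕ-Solver.solve-∀
  2<p : 2 < p
  2<p = subst (2 <_) (sym p≡4e+15q)
          (ℕ.<-≤-trans (s≤s (s≤s (s≤s z≤n)))
                       (ℕ.≤-trans (ℕ.*-monoˡ-≤ 2 (ℕ.*-monoˡ-≤ 2 (toWitness 1≤e))) (ℕ.m≤m+n _ _)))
  sgn≡ : sgn (p / 5) ≡ sgn k₀
  sgn≡ = odd⇒sgn≡ (quotient-odd (e ℕ.* 2) q pp p≡4e+15q 2<p)
    where
    even : ∀ j → 1 ℕ.+ (1 ℕ.+ j ℕ.* 2) ≡ (1 ℕ.+ j) ℕ.* 2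
    even = ℕ-Solver.solve-∀
    odd⇒sgn≡ : ∃[ j ] q ≡ 1 ℕ.+ j ℕ.* 2 → sgn (p / 5) ≡ sgn k₀
    odd⇒sgn≡ (j , q≡1+2j) = begin
      sgn (p / 5)                     ≡⟨ sym (sgn-+-double (p / 5) (1 ℕ.+ j)) ⟩
      sgn (p / 5 ℕ.+ (1 ℕ.+ j) ℕ.* 2) ≡⟨ cong (λ s → sgn (p / 5 ℕ.+ s)) (sym (trans (cong (1 ℕ.+_) q≡1+2j)
                                                                               (even j))) ⟩
      sgn (p / 5 ℕ.+ (1 ℕ.+ q))       ≡⟨ cong sgn p/5+[1+q]≡k₀ ⟩
      sgn k₀                          ∎
  n≡k₀+q : p / 3 ≡ k₀ ℕ.+ q
  n≡k₀+q = trans n≡ (split e q)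
    where
    split : ∀ e q → e ℕ.+ q ℕ.* 5 ≡ e ℕ.+ q ℕ.* 4 ℕ.+ q
    split = ℕ-Solver.solve-∀
  binom≡ : binom (+ (p / 3)) (p / 15) ≡ binom (+ (p / 3)) k₀
  binom≡ = begin
    binom (+ (p / 3)) (p / 15)    ≡⟨ cong₂ (λ n k → binom (+ n) k) n≡k₀+q p/15≡q ⟩
    binom (+ (k₀ ℕ.+ q)) q        ≡⟨ binom-symmetric k₀ q ⟩
    binom (+ (k₀ ℕ.+ q)) k₀       ≡⟨ cong (λ n → binom (+ n) k₀) (sym n≡k₀+q) ⟩
    binom (+ (p / 3)) k₀          ∎

congruence-ordinary : ∀ {p} q c e → Prime p → p ≡ e ℕ.+ (p / 3) ℕ.* 3 → p / 3 ≡ c ℕ.+ q ℕ.* 5 →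
  p % 15 ≡ e ℕ.+ c ℕ.* 3 →
  {_ : True (1 ℕ.≤? e)} {_ : True (e ℕ.≤? c)} {_ : True (c ℕ.<? 5)} {_ : True (e ℕ.≤? (4 ℕ.* c ℕ.+ e) % 5)}
  {_ : False (special? (e ℕ.+ c ℕ.* 3))} → AηCongruence p
congruence-ordinary {p} q c e pp p≡ n≡ p%15≡ {1≤e} {e≤c} {c<5} {e≤s} {ordinary} =
  congruence-from-ordinary (subst (λ r → ¬ SpecialResidue r) (sym p%15≡) (toWitnessFalse ordinary))
    (Aη-ordinary {p} {p / 3} {q} {c} {e} pp p≡ n≡ (toWitness 1≤e)
                 (ℕ.<⇒≤ (ℕ.≤-<-trans (toWitness e≤c) (toWitness c<5))) (toWitness c<5)
                 (toWitness e≤c) (toWitness e≤s))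

-- Digits c = 1, e = 2 mean p = 15q + 5, so p = 5, where Aη(1) = 5 by evaluation.
congruence-5 : AηCongruence 5
congruence-5 = congruence-from-ordinary (from-no (special? 5)) (divides (+ 1) refl)

congruence-digits : ∀ {p} q c e → Prime p → p ≢ 3 → p ≡ e ℕ.+ (p / 3) ℕ.* 3 → p / 3 ≡ c ℕ.+ q ℕ.* 5 →
  p / 15 ≡ q → p % 15 ≡ e ℕ.+ c ℕ.* 3 → c < 5 → e < 3 → AηCongruence p
congruence-digits {p} q c 0 pp p≢3 p≡ _ _ _ _ _ =
  ⊥-elim (p≢3 (sym (prime-∣⇒≡ pp (ℕ.divides (p / 3) p≡) (s≤s (s≤s z≤n)))))
congruence-digits q 0 1 pp _ p≡ n≡ p/15≡ p%15≡ _ _ = congruence-A q 1 pp p≡ n≡ p/15≡ p%15≡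
congruence-digits q 0 2 pp _ p≡ n≡ p/15≡ p%15≡ _ _ = congruence-A q 2 pp p≡ n≡ p/15≡ p%15≡
congruence-digits q 1 1 pp _ p≡ n≡ p/15≡ p%15≡ _ _ = congruence-B q 1 pp p≡ n≡ p/15≡ p%15≡
congruence-digits q 2 2 pp _ p≡ n≡ p/15≡ p%15≡ _ _ = congruence-B q 2 pp p≡ n≡ p/15≡ p%15≡
congruence-digits {p} q 1 2 pp _ p≡ n≡ _ _ _ _ =
  subst AηCongruence (prime-∣⇒≡ pp (ℕ.divides (1 ℕ.+ q ℕ.* 3) p≡5k) (s≤s (s≤s z≤n))) congruence-5
  where
  collect : ∀ q → 2 ℕ.+ (1 ℕ.+ q ℕ.* 5) ℕ.* 3 ≡ (1 ℕ.+ q ℕ.* 3) ℕ.* 5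
  collect = ℕ-Solver.solve-∀
  p≡5k = trans p≡ (trans (cong (λ n → 2 ℕ.+ n ℕ.* 3) n≡) (collect q))
congruence-digits q 2 1 pp _ p≡ n≡ _ p%15≡ _ _ = congruence-ordinary q 2 1 pp p≡ n≡ p%15≡
congruence-digits q 3 1 pp _ p≡ n≡ _ p%15≡ _ _ = congruence-ordinary q 3 1 pp p≡ n≡ p%15≡
congruence-digits q 4 1 pp _ p≡ n≡ _ p%15≡ _ _ = congruence-ordinary q 4 1 pp p≡ n≡ p%15≡
congruence-digits q 3 2 pp _ p≡ n≡ _ p%15≡ _ _ = congruence-ordinary q 3 2 pp p≡ n≡ p%15≡
congruence-digits q 4 2 pp _ p≡ n≡ _ p%15≡ _ _ = congruence-ordinary q 4 2 pp p≡ n≡ p%15≡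
congruence-digits q (suc (suc (suc (suc (suc _))))) _ _ _ _ _ _ _ (s≤s (s≤s (s≤s (s≤s (s≤s ()))))) _
congruence-digits q _ (suc (suc (suc _))) _ _ _ _ _ _ _ (s≤s (s≤s (s≤s ())))

theorem6p4 : (p : ℕ) → Prime p → p ≢ 3 →
    ((p % 15 ≡ 1 ⊎ p % 15 ≡ 2 ⊎ p % 15 ≡ 4 ⊎ p % 15 ≡ 8) →
      (+ p) ∣ (Aη (p / 3) - sgn (p / 5) * (binom (+ (p / 3)) (p / 15) ^ℤ 3)))
    × (¬ (p % 15 ≡ 1 ⊎ p % 15 ≡ 2 ⊎ p % 15 ≡ 4 ⊎ p % 15 ≡ 8) →
      (+ p) ∣ Aη (p / 3))
theorem6p4 p pp p≢3 = congruence-digits (p / 3 / 5) (p / 3 % 5) (p % 3) pp p≢3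
  (ℕ.m≡m%n+[m/n]*n p 3) (ℕ.m≡m%n+[m/n]*n (p / 3) 5) (sym (ℕ.m/n/o≡m/[n*o] p 3 5)) p%15≡
  (ℕ.m%n<n (p / 3) 5) (ℕ.m%n<n p 3)
  where
  p%15≡ : p % 15 ≡ p % 3 ℕ.+ (p / 3 % 5) ℕ.* 3
  p%15≡ = trans (ℕ.m≡m%n+[m/n]*n (p % 15) 3)
                (cong₂ (λ a b → a ℕ.+ b ℕ.* 3) (ℕ.m∣n⇒o%n%m≡o%m 3 15 p (ℕ.divides 5 refl))
                                                (ℕ.m%[n*o]/o≡m/o%n p 5 3))
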